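{- Let $\underline{D}$ be a pure and trivial double Boolean algebra. (1) If $I$ is an ideal of $\underline{D}_\sqcap$ and $F$ is a filter of $\underline{D}_\sqcup$, then the relation $\theta$ defined by $(a,b)\in\theta\iff a+b\in I$ and $a\cdot b\in F$ is a congruence relation on $\underline{D}$. (2) The map $\phi:\mathrm{Con}(\underline{D})\to\mathcal{I}(\underline{D}_\sqcap)\times\mathcal{F}(\underline{D}_\sqcup)$, $\theta\mapsto([\bot]_\theta\cap D_\sqcap,[\top]_\theta\cap D_\sqcup)$, is a lattice isomorphism, whose inverse sends $(I,F)$ to the congruence defined in (1).
   Context: A double Boolean algebra (dBa) is an algebra $\underline{D}=(D;\sqcap,\sqcup,\neg,\lrcorner,\bot,\top)$ of type $(2,2,1,1,0,0)$ satisfying, for all $x,y,z$, where $x\vee y:=\neg(\neg x\sqcap\neg y)$ and $x\wedge y:=\lrcorner(\lrcorner x\sqcup\lrcorner y)$: $(x\sqcap x)\sqcap y=x\sqcap y$; $(x\sqcup x)\sqcup y=x\sqcup y$; $\sqcap$ and $\sqcup$ are commutative and associative; $x\sqcap(x\sqcup y)=x\sqcap x$; $x\sqcup(x\sqcap y)=x\sqcup x$; $x\sqcap(x\vee y)=x\sqcap x$; $x\sqcup(x\wedge y)=x\sqcup x$; $x\sqcap(y\vee z)=(x\sqcap y)\vee(x\sqcap z)$; $x\sqcup(y\wedge z)=(x\sqcup y)\wedge(x\sqcup z)$; $\neg\neg(x\sqcap y)=x\sqcap y$; $\lrcorner\lrcorner(x\sqcup y)=x\sqcup y$; $\neg(x\sqcap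 x)=\neg x$; $\lrcorner(x\sqcup x)=\lrcorner x$; $x\sqcap\neg x=\bot$; $x\sqcup\lrcorner x=\top$; $\neg\bot=\top\sqcap\top$; $\lrcorner\top=\bot\sqcup\bot$; $\neg\top=\bot$; $\lrcorner\bot=\top$; $(x\sqcap x)\sqcup(x\sqcap x)=(x\sqcup x)\sqcap(x\sqcup x)$. $D_\sqcap=\{x: x\sqcap x=x\}$, $D_\sqcup=\{x: x\sqcup x=x\}$; $\underline{D}_\sqcap=(D_\sqcap;\sqcap,\vee,\neg,\bot,\neg\bot)$ and $\underline{D}_\sqcup=(D_\sqcup;\wedge,\sqcup,\lrcorner,\lrcorner\top,\top)$ are Boolean algebras (a known fact). $\underline{D}$ is pure if $D=D_\sqcap\cup D_\sqcup$, trivial if $\top\sqcap\top=\bot\sqcup\bot$. $x+y:=(x\sqcap\neg y)\vee(\neg x\sqcap y)$, $x\cdot y:=(x\sqcup\lrcorner y)\wedge(\lrcorner x\sqcup y)$. $\mathrm{Con}(\underline{D})$ is the lattice of congruences (equivalence relations compatible with $\sqcap,\sqcup,\neg,\lrcorner$), $[a]_\theta$ the $\theta$-class of $a$, $\mathcal{I}(\underline{D}_\sqcap)$ the lattice of ideals of $\underline{D}_\sqcap$ and $\mathcal{F}(\underline{D}_\sqcup)$ the lattice of filters of $\underline{D}_\sqcup$, each ordered by inclusion, and the product is ordered componentwise. -}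

module Defs where

open import Data.Product using (_×_; _,_)
open import Data.Sum using (_⊎_)
open import Relation.Binary.PropositionalEquality using (_≡_)
open import Relation.Binary.Structures using (IsEquivalence)

record DBAOps (D : Set) : Set where
  infixr 7 _⊓_
  infixr 6 _⊔_
  field
    _⊓_ _⊔_ : D → D → D
    ¬_ ⌟_   : D → D
    ⊥ ⊤     : D
  infixr 7 _∧_
  infixr 6 _∨_
  _∨_ : D → D → D
  x ∨ y = ¬ (¬ x ⊓ ¬ y)
  _∧_ : D → D → D
  x ∧ y = ⌟ (⌟ x ⊔ ⌟ y)
  _+_ : D → D → D
  x + y = (x ⊓ ¬ y) ∨ (¬ x ⊓ y)
  _·_ : D → D → D
  x · y = (x ⊔ ⌟ y) ∧ (⌟ x ⊔ y)
  InD⊓ : D → Set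
  InD⊓ x = x ⊓ x ≡ x
  InD⊔ : D → Set
  InD⊔ x = x ⊔ x ≡ x

record IsDBA {D : Set} (O : DBAOps D) : Set where
  open DBAOps O
  field
    ⊓-idem-l  : ∀ x y → (x ⊓ x) ⊓ y ≡ x ⊓ y
    ⊔-idem-l  : ∀ x y → (x ⊔ x) ⊔ y ≡ x ⊔ y
    ⊓-comm    : ∀ x y → x ⊓ y ≡ y ⊓ x
    ⊔-comm    : ∀ x y → x ⊔ y ≡ y ⊔ x
    ⊓-assoc   : ∀ x y z → x ⊓ (y ⊓ z) ≡ (x ⊓ y) ⊓ z
    ⊔-assoc   : ∀ x y z → x ⊔ (y ⊔ z) ≡ (x ⊔ y) ⊔ z
    ⊓-abs-⊔   : ∀ x y → x ⊓ (x ⊔ y) ≡ x ⊓ x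
    ⊔-abs-⊓   : ∀ x y → x ⊔ (x ⊓ y) ≡ x ⊔ x
    ⊓-abs-∨   : ∀ x y → x ⊓ (x ∨ y) ≡ x ⊓ x
    ⊔-abs-∧   : ∀ x y → x ⊔ (x ∧ y) ≡ x ⊔ x
    ⊓-distr-∨ : ∀ x y z → x ⊓ (y ∨ z) ≡ (x ⊓ y) ∨ (x ⊓ z)
    ⊔-distr-∧ : ∀ x y z → x ⊔ (y ∧ z) ≡ (x ⊔ y) ∧ (x ⊔ z)
    ¬¬-⊓      : ∀ x y → ¬ ¬ (x ⊓ y) ≡ x ⊓ y
    ⌟⌟-⊔      : ∀ x y → ⌟ ⌟ (x ⊔ y) ≡ x ⊔ y
    ¬-⊓-idem  : ∀ x → ¬ (x ⊓ x) ≡ ¬ x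
    ⌟-⊔-idem  : ∀ x → ⌟ (x ⊔ x) ≡ ⌟ x
    ⊓-compl   : ∀ x → x ⊓ ¬ x ≡ ⊥
    ⊔-compl   : ∀ x → x ⊔ ⌟ x ≡ ⊤
    ¬⊥        : ¬ ⊥ ≡ ⊤ ⊓ ⊤
    ⌟⊤        : ⌟ ⊤ ≡ ⊥ ⊔ ⊥
    ¬⊤        : ¬ ⊤ ≡ ⊥
    ⌟⊥        : ⌟ ⊥ ≡ ⊤
    mixed     : ∀ x → (x ⊓ x) ⊔ (x ⊓ x) ≡ (x ⊔ x) ⊓ (x ⊔ x)

record DBA : Set₁ where
  field
    Carrier : Set
    ops     : DBAOps Carrier
    isDBA   : IsDBA ops
  open DBAOps ops public
  open IsDBA isDBA public

module _ (𝔻 : DBA) where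
  open DBA 𝔻 renaming (Carrier to D)

  IsPure : Set
  IsPure = ∀ x → InD⊓ x ⊎ InD⊔ x

  IsTrivial : Set
  IsTrivial = ⊤ ⊓ ⊤ ≡ ⊥ ⊔ ⊥

  Subset : Set₁
  Subset = D → Set

  _⊆_ : Subset → Subset → Set
  A ⊆ B = ∀ x → A x → B x

  -- Ideal of the Boolean algebra D_⊓ = (D_⊓; ⊓, ∨, ¬, ⊥, ¬⊥),
  -- whose order is x ≤ y iff x ⊓ y = x.
  record IsIdeal (I : Subset) : Set where
    field
      ⊆D⊓      : ∀ x → I x → InD⊓ x
      has-⊥    : I ⊥
      ∨-closed : ∀ x y → I x → I y → I (x ∨ y)
      ↓-closed : ∀ x y → InD⊓ x → I y → x ⊓ y ≡ x → I x

  -- Filter of the Boolean algebra D_⊔ = (D_⊔; ∧, ⊔, ⌟, ⌟⊤, ⊤),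
  -- whose order is x ≤ y iff x ⊔ y = y.
  record IsFilter (F : Subset) : Set where
    field
      ⊆D⊔      : ∀ x → F x → InD⊔ x
      has-⊤    : F ⊤
      ∧-closed : ∀ x y → F x → F y → F (x ∧ y)
      ↑-closed : ∀ x y → F x → InD⊔ y → x ⊔ y ≡ y → F y

  Relation : Set₁
  Relation = D → D → Set

  _⊆ᵣ_ : Relation → Relation → Set
  θ ⊆ᵣ ψ = ∀ a b → θ a b → ψ a b

  record IsCongruence (θ : Relation) : Set where
    field
      isEquivalence : IsEquivalence θ
      ⊓-cong : ∀ a b c d → θ a b → θ c d → θ (a ⊓ c) (b ⊓ d)
      ⊔-cong : ∀ a b c d → θ a b → θ c d → θ (a ⊔ c) (b ⊔ d)
      ¬-cong : ∀ a b → θ a b → θ (¬ a) (¬ b)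
      ⌟-cong : ∀ a b → θ a b → θ (⌟ a) (⌟ b)

  θ[_,_] : Subset → Subset → Relation
  θ[ I , F ] a b = I (a + b) × F (a · b)

  φ₁ : Relation → Subset
  φ₁ θ x = θ ⊥ x × InD⊓ x

  φ₂ : Relation → Subset
  φ₂ θ x = θ ⊤ x × InD⊔ x

{-# OPTIONS --safe #-}
module Submission where

-- D_⊓ is a Boolean algebra, so an ideal I of it yields the Boolean congruence
-- a + b ∈ I, and the ⊥-class of any congruence is an ideal of D_⊓.  Triviality
-- makes D_⊓ ∩ D_⊔ = {⊤ ⊓ ⊤}; hence all elements of D_⊔ have the same
-- ⊓-projection, + cannot tell them apart, and a + b ∈ I is already compatible
-- with ⊔ and ⌟.  Intersecting with the dual relation a · b ∈ F gives θ_{I,F}.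
-- Conversely a congruence θ relates a and b as soon as it relates both their
-- ⊓- and ⊔-projections: by purity a is one of its projections, and a pair from
-- D_⊓ × D_⊔ is linked through the common element ⊤ ⊓ ⊤ = ⊥ ⊔ ⊥.

open import Defs
open import Level using (0ℓ)
open import Data.Product using (_×_; _,_; proj₂; map; map₁; zip)
open import Data.Sum using (inj₁; inj₂)
open import Relation.Binary.PropositionalEquality
  using (_≡_; refl; sym; trans; cong; cong₂; subst; subst₂; module ≡-Reasoning)
open import Relation.Binary.Structures using (IsEquivalence)
open import Relation.Binary.Construct.Intersection using (_∩_)
  renaming (isEquivalence to ∩-isEquivalence)
open import Algebra.Lattice.Bundles using (BooleanAlgebra)
open import Algebra.Lattice.Structures using (IsLattice)
open import Algebra.Lattice.Structures.Biased
  using (isDistributiveLatticeʳʲᵐ; isBooleanAlgebraʳ)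
import Algebra.Lattice.Properties.BooleanAlgebra as BooleanAlgebraProperties
import Algebra.Lattice.Properties.Lattice as LatticeProperties
import Relation.Binary.Lattice as OrderLattice
import Relation.Binary.Reasoning.Setoid as SetoidReasoning

module D⊓-BooleanAlgebra (𝔻 : DBA) where
  open DBA 𝔻 renaming (Carrier to D)
  open ≡-Reasoning

  ⊓-inD⊓ : ∀ x y → InD⊓ (x ⊓ y)
  ⊓-inD⊓ x y = begin
    (x ⊓ y) ⊓ (x ⊓ y) ≡⟨ ⊓-assoc (x ⊓ y) x y ⟩
    ((x ⊓ y) ⊓ x) ⊓ y ≡⟨ cong (_⊓ y) (⊓-comm (x ⊓ y) x) ⟩
    (x ⊓ (x ⊓ y)) ⊓ y ≡⟨ cong (_⊓ y) (⊓-assoc x x y) ⟩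
    ((x ⊓ x) ⊓ y) ⊓ y ≡⟨ cong (_⊓ y) (⊓-idem-l x y) ⟩
    (x ⊓ y) ⊓ y       ≡⟨ sym (⊓-assoc x y y) ⟩
    x ⊓ (y ⊓ y)       ≡⟨ ⊓-comm x (y ⊓ y) ⟩
    (y ⊓ y) ⊓ x       ≡⟨ ⊓-idem-l y x ⟩
    y ⊓ x             ≡⟨ ⊓-comm y x ⟩
    x ⊓ y             ∎

  ⊓-squares : ∀ x y → (x ⊓ x) ⊓ (y ⊓ y) ≡ x ⊓ y
  ⊓-squares x y = begin
    (x ⊓ x) ⊓ (y ⊓ y) ≡⟨ ⊓-idem-l x (y ⊓ y) ⟩
    x ⊓ (y ⊓ y)       ≡⟨ ⊓-comm x (y ⊓ y) ⟩
    (y ⊓ y) ⊓ x       ≡⟨ ⊓-idem-l y x ⟩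
    y ⊓ x             ≡⟨ ⊓-comm y x ⟩
    x ⊓ y             ∎

  ¬¬x≡x⊓x : ∀ x → ¬ ¬ x ≡ x ⊓ x
  ¬¬x≡x⊓x x = trans (cong ¬_ (sym (¬-⊓-idem x))) (¬¬-⊓ x x)

  ¬-inD⊓ : ∀ x → InD⊓ (¬ x)
  ¬-inD⊓ x = begin
    ¬ x ⊓ ¬ x       ≡⟨ sym (¬¬-⊓ (¬ x) (¬ x)) ⟩
    ¬ ¬ (¬ x ⊓ ¬ x) ≡⟨ cong ¬_ (¬-⊓-idem (¬ x)) ⟩
    ¬ ¬ ¬ x         ≡⟨ cong ¬_ (¬¬x≡x⊓x x) ⟩
    ¬ (x ⊓ x)       ≡⟨ ¬-⊓-idem x ⟩
    ¬ x             ∎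

  ⊥-inD⊓ : InD⊓ ⊥
  ⊥-inD⊓ = subst InD⊓ (⊓-compl ⊤) (⊓-inD⊓ ⊤ (¬ ⊤))

  -- D_⊓ is represented by all of D modulo the retraction x ↦ x ⊓ x onto it,
  -- so that the operations need not be restricted to a subset.
  infix 4 _≈_
  _≈_ : D → D → Set
  x ≈ y = x ⊓ x ≡ y ⊓ y

  ≡⇒≈ : ∀ {x y} → x ≡ y → x ≈ y
  ≡⇒≈ = cong (λ z → z ⊓ z)

  ≈⇒≡ : ∀ {x y} → InD⊓ x → InD⊓ y → x ≈ y → x ≡ y
  ≈⇒≡ x∈D⊓ y∈D⊓ x≈y = trans (sym x∈D⊓) (trans x≈y y∈D⊓)

  ¬-injective : ∀ {x y} → ¬ x ≡ ¬ y → x ≈ y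
  ¬-injective {x} {y} ¬x≡¬y =
    trans (sym (¬¬x≡x⊓x x)) (trans (cong ¬_ ¬x≡¬y) (¬¬x≡x⊓x y))

  ¬-cong-≈ : ∀ {x y} → x ≈ y → ¬ x ≡ ¬ y
  ¬-cong-≈ {x} {y} x≈y = trans (sym (¬-⊓-idem x)) (trans (cong ¬_ x≈y) (¬-⊓-idem y))

  ⊓-cong-≈ : ∀ {x x′ y y′} → x ≈ x′ → y ≈ y′ → x ⊓ y ≡ x′ ⊓ y′
  ⊓-cong-≈ {x} {x′} {y} {y′} x≈x′ y≈y′ =
    trans (sym (⊓-squares x y)) (trans (cong₂ _⊓_ x≈x′ y≈y′) (⊓-squares x′ y′))

  ∨-cong-≈ : ∀ {x x′ y y′} → x ≈ x′ → y ≈ y′ → x ∨ y ≡ x′ ∨ y′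
  ∨-cong-≈ x≈x′ y≈y′ = cong ¬_ (⊓-cong-≈ (≡⇒≈ (¬-cong-≈ x≈x′)) (≡⇒≈ (¬-cong-≈ y≈y′)))

  ¬-∨ : ∀ x y → ¬ (x ∨ y) ≡ ¬ x ⊓ ¬ y
  ¬-∨ x y = ¬¬-⊓ (¬ x) (¬ y)

  ¬-⊓ : ∀ x y → ¬ (x ⊓ y) ≡ ¬ x ∨ ¬ y
  ¬-⊓ x y = cong ¬_ (sym (trans (cong₂ _⊓_ (¬¬x≡x⊓x x) (¬¬x≡x⊓x y)) (⊓-squares x y)))

  ∨-comm : ∀ x y → x ∨ y ≡ y ∨ x
  ∨-comm x y = cong ¬_ (⊓-comm (¬ x) (¬ y))

  ∨-assoc : ∀ x y z → (x ∨ y) ∨ z ≡ x ∨ (y ∨ z)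
  ∨-assoc x y z = cong ¬_ (begin
    ¬ (x ∨ y) ⊓ ¬ z       ≡⟨ cong (_⊓ ¬ z) (¬-∨ x y) ⟩
    (¬ x ⊓ ¬ y) ⊓ ¬ z     ≡⟨ sym (⊓-assoc (¬ x) (¬ y) (¬ z)) ⟩
    ¬ x ⊓ (¬ y ⊓ ¬ z)     ≡⟨ cong (¬ x ⊓_) (sym (¬-∨ y z)) ⟩
    ¬ x ⊓ ¬ (y ∨ z)       ∎)

  ∨-absorbs-⊓ : ∀ x y → x ∨ (x ⊓ y) ≈ x
  ∨-absorbs-⊓ x y = ¬-injective (begin
    ¬ (x ∨ (x ⊓ y))         ≡⟨ ¬-∨ x (x ⊓ y) ⟩
    ¬ x ⊓ ¬ (x ⊓ y)         ≡⟨ cong (λ z → ¬ x ⊓ ¬ z) (sym (⊓-idem-l x y)) ⟩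
    ¬ x ⊓ ¬ ((x ⊓ x) ⊓ y)   ≡⟨ cong (λ z → ¬ x ⊓ ¬ z) (sym (⊓-assoc x x y)) ⟩
    ¬ x ⊓ ¬ (x ⊓ (x ⊓ y))   ≡⟨ cong (¬ x ⊓_) (¬-⊓ x (x ⊓ y)) ⟩
    ¬ x ⊓ (¬ x ∨ ¬ (x ⊓ y)) ≡⟨ ⊓-abs-∨ (¬ x) (¬ (x ⊓ y)) ⟩
    ¬ x ⊓ ¬ x               ≡⟨ ¬-inD⊓ x ⟩
    ¬ x                     ∎)

  ⊓-absorbs-∨ : ∀ x y → x ⊓ (x ∨ y) ≈ x
  ⊓-absorbs-∨ x y = trans (cong (λ z → z ⊓ z) (⊓-abs-∨ x y)) (⊓-inD⊓ x x)

  ∨-distribʳ-⊓ : ∀ x y z → (y ⊓ z) ∨ x ≈ (y ∨ x) ⊓ (z ∨ x)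
  ∨-distribʳ-⊓ x y z = ¬-injective (begin
    ¬ ((y ⊓ z) ∨ x)               ≡⟨ ¬-∨ (y ⊓ z) x ⟩
    ¬ (y ⊓ z) ⊓ ¬ x               ≡⟨ ⊓-comm (¬ (y ⊓ z)) (¬ x) ⟩
    ¬ x ⊓ ¬ (y ⊓ z)               ≡⟨ cong (¬ x ⊓_) (¬-⊓ y z) ⟩
    ¬ x ⊓ (¬ y ∨ ¬ z)             ≡⟨ ⊓-distr-∨ (¬ x) (¬ y) (¬ z) ⟩
    (¬ x ⊓ ¬ y) ∨ (¬ x ⊓ ¬ z)     ≡⟨ cong₂ _∨_ (⊓-comm (¬ x) (¬ y)) (⊓-comm (¬ x) (¬ z)) ⟩
    (¬ y ⊓ ¬ x) ∨ (¬ z ⊓ ¬ x)     ≡⟨ sym (cong₂ _∨_ (¬-∨ y x) (¬-∨ z x)) ⟩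
    ¬ (y ∨ x) ∨ ¬ (z ∨ x)         ≡⟨ sym (¬-⊓ (y ∨ x) (z ∨ x)) ⟩
    ¬ ((y ∨ x) ⊓ (z ∨ x))         ∎)

  ∨-complementʳ : ∀ x → x ∨ ¬ x ≡ ¬ ⊥
  ∨-complementʳ x = cong ¬_ (begin
    ¬ x ⊓ ¬ ¬ x   ≡⟨ cong (¬ x ⊓_) (¬¬x≡x⊓x x) ⟩
    ¬ x ⊓ (x ⊓ x) ≡⟨ ⊓-comm (¬ x) (x ⊓ x) ⟩
    (x ⊓ x) ⊓ ¬ x ≡⟨ ⊓-idem-l x (¬ x) ⟩
    x ⊓ ¬ x       ≡⟨ ⊓-compl x ⟩
    ⊥             ∎)

  isLattice : IsLattice _≈_ _∨_ _⊓_
  isLattice = record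
    { isEquivalence = record { refl = refl ; sym = sym ; trans = trans }
    ; ∨-comm        = λ x y → ≡⇒≈ (∨-comm x y)
    ; ∨-assoc       = λ x y z → ≡⇒≈ (∨-assoc x y z)
    ; ∨-cong        = λ x≈x′ y≈y′ → ≡⇒≈ (∨-cong-≈ x≈x′ y≈y′)
    ; ∧-comm        = λ x y → ≡⇒≈ (⊓-comm x y)
    ; ∧-assoc       = λ x y z → ≡⇒≈ (sym (⊓-assoc x y z))
    ; ∧-cong        = λ x≈x′ y≈y′ → ≡⇒≈ (⊓-cong-≈ x≈x′ y≈y′)
    ; absorptive    = ∨-absorbs-⊓ , ⊓-absorbs-∨
    }

  booleanAlgebra : BooleanAlgebra 0ℓ 0ℓ
  booleanAlgebra = record
    { isBooleanAlgebra = isBooleanAlgebraʳ (record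
      { isDistributiveLattice = isDistributiveLatticeʳʲᵐ (record
        { isLattice    = isLattice
        ; ∨-distribʳ-∧ = ∨-distribʳ-⊓
        })
      ; ∨-complementʳ = λ x → ≡⇒≈ (∨-complementʳ x)
      ; ∧-complementʳ = λ x → ≡⇒≈ (⊓-compl x)
      ; ¬-cong        = λ x≈y → ≡⇒≈ (¬-cong-≈ x≈y)
      })
    }

  ⊓-⊤-identityʳ : ∀ {x} → InD⊓ x → x ⊓ ⊤ ≡ x
  ⊓-⊤-identityʳ {x} x∈D⊓ = trans (cong (x ⊓_) (sym (⊔-compl x))) (trans (⊓-abs-⊔ x (⌟ x)) x∈D⊓)

  ⊓-⊥-zeroʳ : ∀ x → x ⊓ ⊥ ≡ ⊥
  ⊓-⊥-zeroʳ x = begin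
    x ⊓ ⊥         ≡⟨ cong (x ⊓_) (sym (⊓-compl x)) ⟩
    x ⊓ (x ⊓ ¬ x) ≡⟨ ⊓-assoc x x (¬ x) ⟩
    (x ⊓ x) ⊓ ¬ x ≡⟨ ⊓-idem-l x (¬ x) ⟩
    x ⊓ ¬ x       ≡⟨ ⊓-compl x ⟩
    ⊥             ∎

module D⊓-SymmetricDifference (𝔻 : DBA) where
  open DBA 𝔻 renaming (Carrier to D)
  open D⊓-BooleanAlgebra 𝔻 public

  private
    module BA = BooleanAlgebra booleanAlgebra
    module BAP = BooleanAlgebraProperties booleanAlgebra

  open OrderLattice.Lattice (LatticeProperties.∨-∧-orderTheoreticLattice BA.lattice)
    public using (_≤_; ≤-respˡ-≈; x∧y≤x; x∧y≤y)

  open SetoidReasoning BA.setoid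

  +≈xor : ∀ x y → x + y ≈ (x ∨ y) ⊓ ¬ (x ⊓ y)
  +≈xor x y = BA.sym (begin
    (x ∨ y) ⊓ ¬ (x ⊓ y)
      ≈⟨ BA.∧-congˡ (BAP.deMorgan₁ x y) ⟩
    (x ∨ y) ⊓ (¬ x ∨ ¬ y)
      ≈⟨ BA.∧-distribʳ-∨ _ x y ⟩
    (x ⊓ (¬ x ∨ ¬ y)) ∨ (y ⊓ (¬ x ∨ ¬ y))
      ≈⟨ BA.∨-cong (BA.∧-distribˡ-∨ x _ _) (BA.∧-distribˡ-∨ y _ _) ⟩
    ((x ⊓ ¬ x) ∨ (x ⊓ ¬ y)) ∨ ((y ⊓ ¬ x) ∨ (y ⊓ ¬ y))
      ≈⟨ BA.∨-cong (BA.∨-congʳ (BA.∧-complementʳ x)) (BA.∨-congˡ (BA.∧-complementʳ y)) ⟩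
    (⊥ ∨ (x ⊓ ¬ y)) ∨ ((y ⊓ ¬ x) ∨ ⊥)
      ≈⟨ BA.∨-cong (BAP.∨-identityˡ _) (BAP.∨-identityʳ _) ⟩
    (x ⊓ ¬ y) ∨ (y ⊓ ¬ x)
      ≈⟨ BA.∨-congˡ (BA.∧-comm y (¬ x)) ⟩
    x + y
      ∎)

  open BAP.XorRing _+_ +≈xor public using ()
    renaming ( ⊕-cong to +-cong; ⊕-comm to +-comm; ⊕-assoc to +-assoc
             ; ⊕-identityˡ to +-identityˡ; ⊕-inverseˡ to +-inverseˡ
             ; ⊕-annihilates-¬ to +-annihilates-¬
             ; ∧-distribˡ-⊕ to ⊓-distribˡ-+; ∧-distribʳ-⊕ to ⊓-distribʳ-+ )

  x+x≡⊥ : ∀ x → x + x ≡ ⊥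
  x+x≡⊥ x = ≈⇒≡ (¬-inD⊓ _) ⊥-inD⊓ (+-inverseˡ x)

  +-cancelˡ : ∀ x y → x + (x + y) ≈ y
  +-cancelˡ x y = begin
    x + (x + y) ≈⟨ BA.sym (+-assoc x x y) ⟩
    (x + x) + y ≈⟨ +-cong (+-inverseˡ x) BA.refl ⟩
    ⊥ + y       ≈⟨ +-identityˡ y ⟩
    y           ∎

  +-trans : ∀ x y z → (x + y) + (y + z) ≈ x + z
  +-trans x y z = BA.trans (+-assoc x y (y + z)) (+-cong BA.refl (+-cancelˡ y z))

  +≤∨ : ∀ x y → x + y ≤ x ∨ y
  +≤∨ x y = ≤-respˡ-≈ (BA.sym (+≈xor x y)) (x∧y≤x (x ∨ y) (¬ (x ⊓ y)))

  ⊓-+-≤ʳ : ∀ x y z → (x ⊓ z) + (y ⊓ z) ≤ x + y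
  ⊓-+-≤ʳ x y z = ≤-respˡ-≈ (⊓-distribʳ-+ z x y) (x∧y≤x (x + y) z)

  ⊓-+-≤ˡ : ∀ x y z → (z ⊓ x) + (z ⊓ y) ≤ x + y
  ⊓-+-≤ˡ x y z = ≤-respˡ-≈ (⊓-distribˡ-+ z x y) (x∧y≤y z (x + y))

-- Definitionally, the dual exchanges D_⊓ with D_⊔, + with · and φ₁ with φ₂.
dual : DBA → DBA
dual 𝔻 = record
  { Carrier = Carrier
  ; ops     = record { _⊓_ = _⊔_ ; _⊔_ = _⊓_ ; ¬_ = ⌟_ ; ⌟_ = ¬_ ; ⊥ = ⊤ ; ⊤ = ⊥ }
  ; isDBA   = record
    { ⊓-idem-l = ⊔-idem-l ; ⊔-idem-l = ⊓-idem-l ; ⊓-comm = ⊔-comm ; ⊔-comm = ⊓-comm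
    ; ⊓-assoc = ⊔-assoc ; ⊔-assoc = ⊓-assoc ; ⊓-abs-⊔ = ⊔-abs-⊓ ; ⊔-abs-⊓ = ⊓-abs-⊔
    ; ⊓-abs-∨ = ⊔-abs-∧ ; ⊔-abs-∧ = ⊓-abs-∨ ; ⊓-distr-∨ = ⊔-distr-∧ ; ⊔-distr-∧ = ⊓-distr-∨
    ; ¬¬-⊓ = ⌟⌟-⊔ ; ⌟⌟-⊔ = ¬¬-⊓ ; ¬-⊓-idem = ⌟-⊔-idem ; ⌟-⊔-idem = ¬-⊓-idem
    ; ⊓-compl = ⊔-compl ; ⊔-compl = ⊓-compl ; ¬⊥ = ⌟⊤ ; ⌟⊤ = ¬⊥ ; ¬⊤ = ⌟⊥ ; ⌟⊥ = ¬⊤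
    ; mixed = λ x → sym (mixed x)
    }
  }
  where open DBA 𝔻

module D⊔-BooleanAlgebra (𝔻 : DBA) = D⊓-BooleanAlgebra (dual 𝔻)

module _ {𝔻 : DBA} where
  open DBA 𝔻

  filter⇒dual-ideal : ∀ {F} → IsFilter 𝔻 F → IsIdeal (dual 𝔻) F
  filter⇒dual-ideal isF = record
    { ⊆D⊓ = ⊆D⊔ ; has-⊥ = has-⊤ ; ∨-closed = ∧-closed
    ; ↓-closed = λ x y x∈D⊔ Fy y⊔x≡y → ↑-closed y x Fy x∈D⊔ (trans (⊔-comm y x) y⊔x≡y)
    }
    where open IsFilter isF

  dual-ideal⇒filter : ∀ {F} → IsIdeal (dual 𝔻) F → IsFilter 𝔻 F
  dual-ideal⇒filter isF = record
    { ⊆D⊔ = ⊆D⊓ ; has-⊤ = has-⊥ ; ∧-closed = ∨-closed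
    ; ↑-closed = λ x y Fx y∈D⊔ x⊔y≡y → ↓-closed y x y∈D⊔ Fx (trans (⊔-comm y x) x⊔y≡y)
    }
    where open IsIdeal isF

  congruence⇒dual-congruence : ∀ {θ} → IsCongruence 𝔻 θ → IsCongruence (dual 𝔻) θ
  congruence⇒dual-congruence cg = record
    { isEquivalence = isEquivalence ; ⊓-cong = ⊔-cong ; ⊔-cong = ⊓-cong
    ; ¬-cong = ⌟-cong ; ⌟-cong = ¬-cong
    }
    where open IsCongruence cg

  dual-congruence⇒congruence : ∀ {θ} → IsCongruence (dual 𝔻) θ → IsCongruence 𝔻 θ
  dual-congruence⇒congruence cg = record
    { isEquivalence = isEquivalence ; ⊓-cong = ⊔-cong ; ⊔-cong = ⊓-cong
    ; ¬-cong = ⌟-cong ; ⌟-cong = ¬-cong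
    }
    where open IsCongruence cg

  ∩-isCongruence : ∀ {θ ψ} → IsCongruence 𝔻 θ → IsCongruence 𝔻 ψ → IsCongruence 𝔻 (θ ∩ ψ)
  ∩-isCongruence cθ cψ = record
    { isEquivalence = ∩-isEquivalence (isEquivalence cθ) (isEquivalence cψ)
    ; ⊓-cong = λ a b c d → zip (⊓-cong cθ a b c d) (⊓-cong cψ a b c d)
    ; ⊔-cong = λ a b c d → zip (⊔-cong cθ a b c d) (⊔-cong cψ a b c d)
    ; ¬-cong = λ a b → map (¬-cong cθ a b) (¬-cong cψ a b)
    ; ⌟-cong = λ a b → map (⌟-cong cθ a b) (⌟-cong cψ a b)
    }
    where open IsCongruence

module Trivial (𝔻 : DBA) (trivial : IsTrivial 𝔻) where
  open DBA 𝔻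
  open D⊓-SymmetricDifference 𝔻
  private module D⊔ = D⊔-BooleanAlgebra 𝔻
  open ≡-Reasoning

  D⊓∩D⊔≡⊤⊓⊤ : ∀ {x} → InD⊓ x → InD⊔ x → x ≡ ⊤ ⊓ ⊤
  D⊓∩D⊔≡⊤⊓⊤ {x} x∈D⊓ x∈D⊔ = begin
    x                           ≡⟨ sym x⊓⊤≡x ⟩
    x ⊓ ⊤                       ≡⟨ cong (_⊓ ⊤) (sym x⊓⊤≡x) ⟩
    (x ⊓ ⊤) ⊓ ⊤                 ≡⟨ sym (⊓-assoc x ⊤ ⊤) ⟩
    x ⊓ (⊤ ⊓ ⊤)                 ≡⟨ ⊓-comm x (⊤ ⊓ ⊤) ⟩
    (⊤ ⊓ ⊤) ⊓ x                 ≡⟨ cong ((⊤ ⊓ ⊤) ⊓_) (sym ⊤⊓⊤⊔x≡x) ⟩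
    (⊤ ⊓ ⊤) ⊓ ((⊤ ⊓ ⊤) ⊔ x)     ≡⟨ ⊓-abs-⊔ (⊤ ⊓ ⊤) x ⟩
    (⊤ ⊓ ⊤) ⊓ (⊤ ⊓ ⊤)           ≡⟨ ⊓-inD⊓ ⊤ ⊤ ⟩
    ⊤ ⊓ ⊤                       ∎
    where
    x⊓⊤≡x : x ⊓ ⊤ ≡ x
    x⊓⊤≡x = ⊓-⊤-identityʳ x∈D⊓
    ⊤⊓⊤⊔x≡x : (⊤ ⊓ ⊤) ⊔ x ≡ x
    ⊤⊓⊤⊔x≡x = begin
      (⊤ ⊓ ⊤) ⊔ x ≡⟨ cong (_⊔ x) trivial ⟩
      (⊥ ⊔ ⊥) ⊔ x ≡⟨ ⊔-idem-l ⊥ x ⟩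
      ⊥ ⊔ x       ≡⟨ ⊔-comm ⊥ x ⟩
      x ⊔ ⊥       ≡⟨ D⊔.⊓-⊤-identityʳ x∈D⊔ ⟩
      x           ∎

  D⊔-⊓-projection : ∀ {u} → InD⊔ u → u ⊓ u ≡ ⊤ ⊓ ⊤
  D⊔-⊓-projection {u} u∈D⊔ =
    D⊓∩D⊔≡⊤⊓⊤ (⊓-inD⊓ u u) (trans (mixed u) (cong (λ z → z ⊓ z) u∈D⊔))

  D⊔-+≡⊥ : ∀ {u v} → InD⊔ u → InD⊔ v → u + v ≡ ⊥
  D⊔-+≡⊥ {u} {v} u∈D⊔ v∈D⊔ = ≈⇒≡ (¬-inD⊓ _) ⊥-inD⊓ (trans (+-cong refl v≈u) (+-inverseˡ u))
    where
    v≈u : v ≈ u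
    v≈u = trans (D⊔-⊓-projection v∈D⊔) (sym (D⊔-⊓-projection u∈D⊔))

module _ {𝔻 : DBA} {I : Subset 𝔻} (isI : IsIdeal 𝔻 I) where
  open DBA 𝔻
  open D⊓-SymmetricDifference 𝔻
  open IsIdeal isI

  ideal-resp-≈ : ∀ {x y} → InD⊓ y → x ≈ y → I x → I y
  ideal-resp-≈ {x} y∈D⊓ x≈y Ix = subst I (≈⇒≡ (⊆D⊓ x Ix) y∈D⊓ x≈y) Ix

  ideal-≤-closed : ∀ {x y} → InD⊓ x → x ≤ y → I y → I x
  ideal-≤-closed {x} {y} x∈D⊓ x≤y Iy = ↓-closed x y x∈D⊓ Iy (sym (≈⇒≡ x∈D⊓ (⊓-inD⊓ x y) x≤y))

  +∈ideal-trans : ∀ {a b c} → I (a + b) → I (b + c) → I (a + c)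
  +∈ideal-trans {a} {b} {c} Ia+b Ib+c = ideal-≤-closed (¬-inD⊓ _)
    (≤-respˡ-≈ (+-trans a b c) (+≤∨ (a + b) (b + c))) (∨-closed _ _ Ia+b Ib+c)

  +∈ideal-⊓-cong : ∀ {a b c d} → I (a + b) → I (c + d) → I ((a ⊓ c) + (b ⊓ d))
  +∈ideal-⊓-cong {a} {b} {c} {d} Ia+b Ic+d = +∈ideal-trans
    (ideal-≤-closed (¬-inD⊓ _) (⊓-+-≤ʳ a b c) Ia+b)
    (ideal-≤-closed (¬-inD⊓ _) (⊓-+-≤ˡ c d b) Ic+d)

  ⊥+∈ideal⇒∈ideal : ∀ {x} → InD⊓ x → I (⊥ + x) → I x
  ⊥+∈ideal⇒∈ideal {x} x∈D⊓ = ideal-resp-≈ x∈D⊓ (+-identityˡ x)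

  ∈ideal⇒⊥+∈ideal : ∀ {x} → I x → I (⊥ + x)
  ∈ideal⇒⊥+∈ideal {x} = ideal-resp-≈ (¬-inD⊓ _) (sym (+-identityˡ x))

  D⊔-+∈ideal : IsTrivial 𝔻 → ∀ {u v} → InD⊔ u → InD⊔ v → I (u + v)
  D⊔-+∈ideal trivial u∈D⊔ v∈D⊔ = subst I (sym (Trivial.D⊔-+≡⊥ 𝔻 trivial u∈D⊔ v∈D⊔)) has-⊥

  +∈ideal-isCongruence : IsTrivial 𝔻 → IsCongruence 𝔻 (λ a b → I (a + b))
  +∈ideal-isCongruence trivial = record
    { isEquivalence = record
      { refl  = λ {a} → subst I (sym (x+x≡⊥ a)) has-⊥
      ; sym   = λ {a} {b} → ideal-resp-≈ (¬-inD⊓ _) (+-comm a b)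
      ; trans = +∈ideal-trans
      }
    ; ⊓-cong = λ _ _ _ _ → +∈ideal-⊓-cong
    ; ⊔-cong = λ a b c d _ _ → D⊔-+∈ideal trivial (D⊔.⊓-inD⊓ a c) (D⊔.⊓-inD⊓ b d)
    ; ¬-cong = λ a b → ideal-resp-≈ (¬-inD⊓ _) (+-annihilates-¬ a b)
    ; ⌟-cong = λ a b _ → D⊔-+∈ideal trivial (D⊔.¬-inD⊓ a) (D⊔.¬-inD⊓ b)
    }
    where module D⊔ = D⊔-BooleanAlgebra 𝔻

module _ {𝔻 : DBA} {θ : Relation 𝔻} (cg : IsCongruence 𝔻 θ) where
  open DBA 𝔻
  open D⊓-SymmetricDifference 𝔻
  open IsCongruence cg
  open IsEquivalence isEquivalence using () renaming (refl to θ-refl)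

  congruence-∨ : ∀ {a a′ b b′} → θ a a′ → θ b b′ → θ (a ∨ b) (a′ ∨ b′)
  congruence-∨ θaa′ θbb′ = ¬-cong _ _ (⊓-cong _ _ _ _ (¬-cong _ _ θaa′) (¬-cong _ _ θbb′))

  congruence-+ : ∀ {a a′ b b′} → θ a a′ → θ b b′ → θ (a + b) (a′ + b′)
  congruence-+ θaa′ θbb′ =
    congruence-∨ (⊓-cong _ _ _ _ θaa′ (¬-cong _ _ θbb′)) (⊓-cong _ _ _ _ (¬-cong _ _ θaa′) θbb′)

  related⇒+∈⊥-class : ∀ {a b} → θ a b → θ ⊥ (a + b)
  related⇒+∈⊥-class {a} {b} θab = subst (λ z → θ z (a + b)) (x+x≡⊥ a) (congruence-+ θ-refl θab)

  -- Add a to both sides: a + ⊥ ≈ a and a + (a + b) ≈ b.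
  +∈⊥-class⇒⊓-related : ∀ {a b} → θ ⊥ (a + b) → θ (a ⊓ a) (b ⊓ b)
  +∈⊥-class⇒⊓-related {a} {b} θ⊥a+b = subst₂ θ
    (≈⇒≡ (¬-inD⊓ _) (⊓-inD⊓ a a) (trans (+-comm a ⊥) (trans (+-identityˡ a) (sym (⊓-inD⊓ a a)))))
    (≈⇒≡ (¬-inD⊓ _) (⊓-inD⊓ b b) (trans (+-cancelˡ a b) (sym (⊓-inD⊓ b b))))
    (congruence-+ (θ-refl {a}) θ⊥a+b)

  φ₁-isIdeal : IsIdeal 𝔻 (φ₁ 𝔻 θ)
  φ₁-isIdeal = record
    { ⊆D⊓      = λ _ → proj₂
    ; has-⊥    = θ-refl , ⊥-inD⊓
    ; ∨-closed = λ x y (θ⊥x , _) (θ⊥y , _) →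
        subst (λ z → θ z (x ∨ y)) ⊥∨⊥≡⊥ (congruence-∨ θ⊥x θ⊥y) , ¬-inD⊓ _
    ; ↓-closed = λ x y x∈D⊓ (θ⊥y , _) x⊓y≡x →
        subst₂ θ (⊓-⊥-zeroʳ x) x⊓y≡x (⊓-cong x x ⊥ y θ-refl θ⊥y) , x∈D⊓
    }
    where
    ⊥∨⊥≡⊥ : ⊥ ∨ ⊥ ≡ ⊥
    ⊥∨⊥≡⊥ = trans (cong ¬_ (¬-inD⊓ ⊥)) (trans (¬¬x≡x⊓x ⊥) ⊥-inD⊓)

module _ (𝔻 : DBA) (trivial : IsTrivial 𝔻) {θ : Relation 𝔻} (θ-isEquivalence : IsEquivalence θ) where
  open DBA 𝔻
  open IsEquivalence θ-isEquivalence using () renaming (sym to θ-sym; trans to θ-trans)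

  -- θ a (b ⊓ b) and θ (a ⊔ a) b, where b ⊓ b = ⊤ ⊓ ⊤ = ⊥ ⊔ ⊥ = a ⊔ a by triviality.
  D⊓-D⊔-related-by-projections : ∀ {a b} → InD⊓ a → InD⊔ b →
    θ (a ⊓ a) (b ⊓ b) → θ (a ⊔ a) (b ⊔ b) → θ a b
  D⊓-D⊔-related-by-projections a∈D⊓ b∈D⊔ θ⊓ θ⊔ = θ-trans
    (subst₂ θ a∈D⊓ (trans (Trivial.D⊔-⊓-projection 𝔻 trivial b∈D⊔) trivial) θ⊓)
    (subst₂ θ (Trivial.D⊔-⊓-projection (dual 𝔻) (sym trivial) a∈D⊓) b∈D⊔ θ⊔)

  related-by-projections : IsPure 𝔻 → ∀ {a b} →
    θ (a ⊓ a) (b ⊓ b) → θ (a ⊔ a) (b ⊔ b) → θ a b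
  related-by-projections pure {a} {b} θ⊓ θ⊔ with pure a | pure b
  ... | inj₁ a∈D⊓ | inj₁ b∈D⊓ = subst₂ θ a∈D⊓ b∈D⊓ θ⊓
  ... | inj₂ a∈D⊔ | inj₂ b∈D⊔ = subst₂ θ a∈D⊔ b∈D⊔ θ⊔
  ... | inj₁ a∈D⊓ | inj₂ b∈D⊔ = D⊓-D⊔-related-by-projections a∈D⊓ b∈D⊔ θ⊓ θ⊔
  ... | inj₂ a∈D⊔ | inj₁ b∈D⊓ =
    θ-sym (D⊓-D⊔-related-by-projections b∈D⊓ a∈D⊔ (θ-sym θ⊓) (θ-sym θ⊔))

module _ {𝔻 : DBA} where
  open DBA 𝔻
  open D⊓-BooleanAlgebra 𝔻 using (⊥-inD⊓; ¬-inD⊓)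
  private module D⊔ = D⊔-BooleanAlgebra 𝔻

  -- θ[ I , F ] is definitionally (λ a b → I (a + b)) ∩ (λ a b → F (a · b)),
  -- and the second relation is the first one for the dual.
  θ[I,F]-isCongruence : IsTrivial 𝔻 → ∀ {I F} → IsIdeal 𝔻 I → IsFilter 𝔻 F →
    IsCongruence 𝔻 (θ[_,_] 𝔻 I F)
  θ[I,F]-isCongruence trivial isI isF = ∩-isCongruence
    (+∈ideal-isCongruence isI trivial)
    (dual-congruence⇒congruence (+∈ideal-isCongruence (filter⇒dual-ideal isF) (sym trivial)))

  φ₂-isFilter : ∀ {θ} → IsCongruence 𝔻 θ → IsFilter 𝔻 (φ₂ 𝔻 θ)
  φ₂-isFilter cg = dual-ideal⇒filter (φ₁-isIdeal (congruence⇒dual-congruence cg))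

  θ⊆θ[φ₁θ,φ₂θ] : ∀ {θ} → IsCongruence 𝔻 θ → _⊆ᵣ_ 𝔻 θ (θ[_,_] 𝔻 (φ₁ 𝔻 θ) (φ₂ 𝔻 θ))
  θ⊆θ[φ₁θ,φ₂θ] cg _ _ θab =
      (related⇒+∈⊥-class cg θab , ¬-inD⊓ _)
    , (related⇒+∈⊥-class (congruence⇒dual-congruence cg) θab , D⊔.¬-inD⊓ _)

  θ[φ₁θ,φ₂θ]⊆θ : IsPure 𝔻 → IsTrivial 𝔻 → ∀ {θ} → IsCongruence 𝔻 θ →
    _⊆ᵣ_ 𝔻 (θ[_,_] 𝔻 (φ₁ 𝔻 θ) (φ₂ 𝔻 θ)) θ
  θ[φ₁θ,φ₂θ]⊆θ pure trivial cg _ _ ((θ⊥a+b , _) , (θ⊤a·b , _)) =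
    related-by-projections 𝔻 trivial (IsCongruence.isEquivalence cg) pure
      (+∈⊥-class⇒⊓-related cg θ⊥a+b)
      (+∈⊥-class⇒⊓-related (congruence⇒dual-congruence cg) θ⊤a·b)

  φ₁θ[I,F]⊆I : ∀ {I} F → IsIdeal 𝔻 I → _⊆_ 𝔻 (φ₁ 𝔻 (θ[_,_] 𝔻 I F)) I
  φ₁θ[I,F]⊆I _ isI _ ((I⊥+x , _) , x∈D⊓) = ⊥+∈ideal⇒∈ideal isI x∈D⊓ I⊥+x

  φ₂θ[I,F]⊆F : ∀ I {F} → IsFilter 𝔻 F → _⊆_ 𝔻 (φ₂ 𝔻 (θ[_,_] 𝔻 I F)) F
  φ₂θ[I,F]⊆F _ isF _ ((_ , F⊤·x) , x∈D⊔) = ⊥+∈ideal⇒∈ideal (filter⇒dual-ideal isF) x∈D⊔ F⊤·x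

  I⊆φ₁θ[I,F] : IsTrivial 𝔻 → ∀ {I F} → IsIdeal 𝔻 I → IsFilter 𝔻 F →
    _⊆_ 𝔻 I (φ₁ 𝔻 (θ[_,_] 𝔻 I F))
  I⊆φ₁θ[I,F] trivial isI isF x Ix =
      ( ∈ideal⇒⊥+∈ideal isI Ix
      , D⊔-+∈ideal (filter⇒dual-ideal isF) (sym trivial) ⊥-inD⊓ x∈D⊓ )
    , x∈D⊓
    where
    x∈D⊓ : InD⊓ x
    x∈D⊓ = IsIdeal.⊆D⊓ isI x Ix

  F⊆φ₂θ[I,F] : IsTrivial 𝔻 → ∀ {I F} → IsIdeal 𝔻 I → IsFilter 𝔻 F →
    _⊆_ 𝔻 F (φ₂ 𝔻 (θ[_,_] 𝔻 I F))
  F⊆φ₂θ[I,F] trivial isI isF x Fx =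
      ( D⊔-+∈ideal isI trivial D⊔.⊥-inD⊓ x∈D⊔
      , ∈ideal⇒⊥+∈ideal (filter⇒dual-ideal isF) Fx )
    , x∈D⊔
    where
    x∈D⊔ : InD⊔ x
    x∈D⊔ = IsFilter.⊆D⊔ isF x Fx

corollary3p8 : (𝔻 : DBA) → IsPure 𝔻 → IsTrivial 𝔻 →
    -- (1) θ_{I,F} is a congruence
    ((I F : Subset 𝔻) → IsIdeal 𝔻 I → IsFilter 𝔻 F → IsCongruence 𝔻 (θ[_,_] 𝔻 I F))
    -- (2) φ is well defined into I(D_⊓) × F(D_⊔)
    × ((θ : Relation 𝔻) → IsCongruence 𝔻 θ → IsIdeal 𝔻 (φ₁ 𝔻 θ) × IsFilter 𝔻 (φ₂ 𝔻 θ))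
    -- φ is monotone (order preserving)
    × ((θ ψ : Relation 𝔻) → IsCongruence 𝔻 θ → IsCongruence 𝔻 ψ → _⊆ᵣ_ 𝔻 θ ψ →
         _⊆_ 𝔻 (φ₁ 𝔻 θ) (φ₁ 𝔻 ψ) × _⊆_ 𝔻 (φ₂ 𝔻 θ) (φ₂ 𝔻 ψ))
    -- the inverse (I , F) ↦ θ_{I,F} is monotone
    × ((I J F G : Subset 𝔻) → IsIdeal 𝔻 I → IsIdeal 𝔻 J → IsFilter 𝔻 F → IsFilter 𝔻 G →
         _⊆_ 𝔻 I J → _⊆_ 𝔻 F G → _⊆ᵣ_ 𝔻 (θ[_,_] 𝔻 I F) (θ[_,_] 𝔻 J G))
    -- θ_{φ(θ)} = θ
    × ((θ : Relation 𝔻) → IsCongruence 𝔻 θ →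
         _⊆ᵣ_ 𝔻 (θ[_,_] 𝔻 (φ₁ 𝔻 θ) (φ₂ 𝔻 θ)) θ × _⊆ᵣ_ 𝔻 θ (θ[_,_] 𝔻 (φ₁ 𝔻 θ) (φ₂ 𝔻 θ)))
    -- φ(θ_{I,F}) = (I , F)
    × ((I F : Subset 𝔻) → IsIdeal 𝔻 I → IsFilter 𝔻 F →
         (_⊆_ 𝔻 (φ₁ 𝔻 (θ[_,_] 𝔻 I F)) I × _⊆_ 𝔻 I (φ₁ 𝔻 (θ[_,_] 𝔻 I F)))
         × (_⊆_ 𝔻 (φ₂ 𝔻 (θ[_,_] 𝔻 I F)) F × _⊆_ 𝔻 F (φ₂ 𝔻 (θ[_,_] 𝔻 I F))))
corollary3p8 𝔻 pure trivial =
    (λ _ _ → θ[I,F]-isCongruence trivial)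
  , (λ _ cg → φ₁-isIdeal cg , φ₂-isFilter cg)
  , (λ _ _ _ _ θ⊆ψ → (λ _ → map₁ (θ⊆ψ _ _)) , (λ _ → map₁ (θ⊆ψ _ _)))
  , (λ _ _ _ _ _ _ _ _ I⊆J F⊆G _ _ → map (I⊆J _) (F⊆G _))
  , (λ _ cg → θ[φ₁θ,φ₂θ]⊆θ pure trivial cg , θ⊆θ[φ₁θ,φ₂θ] cg)
  , (λ I F isI isF →
        (φ₁θ[I,F]⊆I F isI , I⊆φ₁θ[I,F] trivial isI isF)
      , (φ₂θ[I,F]⊆F I isF , F⊆φ₂θ[I,F] trivial isI isF))
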